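{- Let $\Gamma,\Gamma'$ be $\aleph_1$-saturated discretely ordered abelian groups with minimal positive elements $1_\Gamma$ and $1_{\Gamma'}$ respectively. If $\Gamma\preceq\Gamma'$ (elementary substructure in the language of ordered groups $\{0,+,-,\leq\}$), then $\Gamma/\langle 1_\Gamma\rangle_{conv}\preceq \Gamma'/\langle 1_{\Gamma'}\rangle_{conv}$, where the quotients carry the induced ordering.
   Context: $\langle 1_\Gamma\rangle_{conv}$ denotes the smallest convex subgroup of $\Gamma$ containing $1_\Gamma$ (i.e. the set of $x$ with $|x|\leq n1_\Gamma$ for some $n\in\mathbb{N}$); the quotient of an ordered abelian group by a convex subgroup is an ordered abelian group with the induced order, and $\Gamma/\langle1_\Gamma\rangle_{conv}$ is naturally a subgroup of $\Gamma'/\langle1_{\Gamma'}\rangle_{conv}$ when $\Gamma\preceq\Gamma'$. -}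

module Defs where

open import Level using (0ℓ)
open import Data.Nat using (ℕ; zero; suc)
open import Data.Fin using (Fin)
open import Data.List using (List)
open import Data.List.Relation.Unary.All using (All)
open import Data.Product using (Σ; ∃; _×_; _,_)
open import Data.Sum using (_⊎_)
open import Data.Empty using (⊥)
open import Relation.Nullary using (¬_)
open import Relation.Binary.Structures using (IsEquivalence)
open import Data.Vec.Functional using (Vector; _∷_)
open import Function using (_∘_)
open import Function.Bundles using (_⇔_)

-- Structures for the language of ordered groups {0, +, -, ≤}
-- (equality symbol interpreted by a setoid equality _≈_)

record OStr : Set₁ where
  field
    Carrier : Set
    _≈_     : Carrier → Carrier → Set
    0#      : Carrier
    _+_     : Carrier → Carrier → Carrier
    -_      : Carrier → Carrier
    _≤_     : Carrier → Carrier → Set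

data Term (n : ℕ) : Set where
  var  : Fin n → Term n
  zer  : Term n
  plus : Term n → Term n → Term n
  neg  : Term n → Term n

data Formula : ℕ → Set where
  eqF  : ∀ {n} → Term n → Term n → Formula n
  leF  : ∀ {n} → Term n → Term n → Formula n
  notF : ∀ {n} → Formula n → Formula n
  andF : ∀ {n} → Formula n → Formula n → Formula n
  exF  : ∀ {n} → Formula (suc n) → Formula n

module _ (M : OStr) where
  open OStr M

  evalT : ∀ {n} → Term n → Vector Carrier n → Carrier
  evalT (var i)    ρ = ρ i
  evalT zer        ρ = 0#
  evalT (plus s t) ρ = evalT s ρ + evalT t ρ
  evalT (neg t)    ρ = - evalT t ρ

  Sat : ∀ {n} → Formula n → Vector Carrier n → Set
  Sat (eqF s t)  ρ = evalT s ρ ≈ evalT t ρ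
  Sat (leF s t)  ρ = evalT s ρ ≤ evalT t ρ
  Sat (notF φ)   ρ = ¬ Sat φ ρ
  Sat (andF φ ψ) ρ = Sat φ ρ × Sat ψ ρ
  Sat (exF φ)    ρ = Σ Carrier λ x → Sat φ (x ∷ ρ)

IsElementary : (M N : OStr) → (OStr.Carrier M → OStr.Carrier N) → Set
IsElementary M N f =
  ∀ {n} (φ : Formula n) (ρ : Vector (OStr.Carrier M) n) → Sat M φ ρ ⇔ Sat N φ (f ∘ ρ)

-- A countable parameter set is given by an
-- enumeration a : ℕ → M; a formula over it is a formula φ(x, y₁..y_k)
-- together with the indices of the parameters substituted for y₁..y_k.

ParamFormula : Set
ParamFormula = Σ ℕ λ k → Formula (suc k) × (Fin k → ℕ)

module _ (M : OStr) where
  open OStr M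

  SatP : (ℕ → Carrier) → Carrier → ParamFormula → Set
  SatP a x (k , φ , idx) = Sat M φ (x ∷ (a ∘ idx))

  FinitelySatisfiable : (ℕ → Carrier) → (ParamFormula → Set) → Set
  FinitelySatisfiable a p =
    (L : List ParamFormula) → All p L → Σ Carrier λ x → All (SatP a x) L

  Realised : (ℕ → Carrier) → (ParamFormula → Set) → Set
  Realised a p = Σ Carrier λ x → ∀ ψ → p ψ → SatP a x ψ

IsAleph1Saturated : OStr → Set₁
IsAleph1Saturated M =
  (a : ℕ → OStr.Carrier M) (p : ParamFormula → Set) →
  FinitelySatisfiable M a p → Realised M a p

record DOAG : Set₁ where
  field
    str : OStr
  open OStr str public
  field
    one     : Carrier
    ≈-equiv : IsEquivalence _≈_
    +-cong  : ∀ {x x' y y'} → x ≈ x' → y ≈ y' → (x + y) ≈ (x' + y')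
    neg-cong : ∀ {x x'} → x ≈ x' → (- x) ≈ (- x')
    ≤-resp  : ∀ {x x' y y'} → x ≈ x' → y ≈ y' → x ≤ y → x' ≤ y'
    +-assoc : ∀ x y z → ((x + y) + z) ≈ (x + (y + z))
    +-comm  : ∀ x y → (x + y) ≈ (y + x)
    +-idʳ   : ∀ x → (x + 0#) ≈ x
    +-invʳ  : ∀ x → (x + (- x)) ≈ 0#
    ≤-refl  : ∀ x → x ≤ x
    ≤-antisym : ∀ {x y} → x ≤ y → y ≤ x → x ≈ y
    ≤-trans : ∀ {x y z} → x ≤ y → y ≤ z → x ≤ z
    ≤-total : ∀ x y → x ≤ y ⊎ y ≤ x
    ≤-+     : ∀ {x y} z → x ≤ y → (x + z) ≤ (y + z)
    one-pos : 0# ≤ one × ¬ (one ≈ 0#)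
    one-min : ∀ x → 0# ≤ x → ¬ (x ≈ 0#) → one ≤ x

  n·1 : ℕ → Carrier
  n·1 zero    = 0#
  n·1 (suc n) = n·1 n + one

  InConv1 : Carrier → Set
  InConv1 x = ∃ λ n → ((- n·1 n) ≤ x) × (x ≤ n·1 n)

  Quot : OStr
  Quot = record
    { Carrier = Carrier
    ; _≈_     = λ x y → InConv1 (x + (- y))
    ; 0#      = 0#
    ; _+_     = _+_
    ; -_      = -_
    ; _≤_     = λ x y → (x ≤ y) ⊎ InConv1 (x + (- y))
    }

-- Equality and order in Γ / ⟨1⟩ are countable disjunctions of first-order formulas of the
-- group language: x − y ∈ ⟨1⟩ iff −n·u ≤ x − y ≤ n·u for some n, where u is the least
-- positive element, and "u is the least positive element" is first-order.  Hence tuples of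
-- Γ and Γ' with the same complete type satisfy the same atomic formulas of the quotients.
-- By ℵ₁-saturation a pair of tuples with the same type can be extended by one element on
-- either side keeping the types equal, so by induction on formulas such tuples satisfy the
-- same formulas of the quotients.  An elementary embedding gives ρ and f ∘ ρ the same type.
module Submission where

open import Defs
open import Level using (0ℓ)
open import Axiom.ExcludedMiddle using (ExcludedMiddle)
open import Data.Nat using (ℕ; zero; suc)
open import Data.Fin using (Fin; zero; suc; toℕ)
open import Data.List.Relation.Unary.All as All using (All)
open import Data.Product using (Σ; ∃; _×_; _,_; proj₁; proj₂)
import Data.Sum as Sum
open import Data.Sum using (_⊎_)
open import Data.Empty using (⊥-elim)
open import Relation.Nullary using (yes; no)
open import Relation.Binary.PropositionalEquality as ≡ using (_≡_; refl; cong; cong₂; subst; subst₂)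
open import Relation.Binary.Structures using (IsEquivalence)
open import Data.Vec.Functional using (Vector; _∷_)
open import Function using (_∘_; id)
open import Function.Bundles using (_⇔_; mk⇔; Equivalence)

wkT : ∀ {n} → Term n → Term (suc n)
wkT (var i)    = var (suc i)
wkT zer        = zer
wkT (plus s t) = plus (wkT s) (wkT t)
wkT (neg t)    = neg (wkT t)

times₀ : ∀ {k} → ℕ → Term (suc k)
times₀ zero    = zer
times₀ (suc n) = plus (times₀ n) (var zero)

⊤F : ∀ {n} → Formula n
⊤F = notF (andF (leF zer zer) (notF (leF zer zer)))

IsMinPosF : ∀ {k} → Formula (suc k)
IsMinPosF = andF (leF zer (var zero)) (andF (notF (eqF (var zero) zer))
  (notF (exF (andF (leF zer (var zero)) (andF (notF (eqF (var zero) zer))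
    (notF (leF (var (suc zero)) (var zero))))))))

InConvF : ∀ {k} → ℕ → Term k → Formula k
InConvF n d = exF (andF IsMinPosF (andF (leF (neg (times₀ n)) (wkT d)) (leF (wkT d) (times₀ n))))

module _ (M : OStr) where
  open OStr M

  evalT-wkT : ∀ {n} (t : Term n) x (ρ : Vector Carrier n) → evalT M (wkT t) (x ∷ ρ) ≡ evalT M t ρ
  evalT-wkT (var i)    x ρ = refl
  evalT-wkT zer        x ρ = refl
  evalT-wkT (plus s t) x ρ = cong₂ _+_ (evalT-wkT s x ρ) (evalT-wkT t x ρ)
  evalT-wkT (neg t)    x ρ = cong -_ (evalT-wkT t x ρ)

  evalT-ext : ∀ {n} (t : Term n) {ρ ρ' : Vector Carrier n} →
    (∀ i → ρ i ≡ ρ' i) → evalT M t ρ ≡ evalT M t ρ'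
  evalT-ext (var i)    e = e i
  evalT-ext zer        e = refl
  evalT-ext (plus s t) e = cong₂ _+_ (evalT-ext s e) (evalT-ext t e)
  evalT-ext (neg t)    e = cong -_ (evalT-ext t e)

  Sat-ext : ∀ {n} (φ : Formula n) {ρ ρ' : Vector Carrier n} →
    (∀ i → ρ i ≡ ρ' i) → Sat M φ ρ → Sat M φ ρ'
  Sat-ext (eqF s t)  e h         = subst₂ _≈_ (evalT-ext s e) (evalT-ext t e) h
  Sat-ext (leF s t)  e h         = subst₂ _≤_ (evalT-ext s e) (evalT-ext t e) h
  Sat-ext (notF φ)   e h         = λ h' → h (Sat-ext φ (≡.sym ∘ e) h')
  Sat-ext (andF φ ψ) e (h₁ , h₂) = Sat-ext φ e h₁ , Sat-ext ψ e h₂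
  Sat-ext (exF φ)    e (x , h)   = x , Sat-ext φ e∷ h
    where
    e∷ : ∀ i → (x ∷ _) i ≡ (x ∷ _) i
    e∷ zero    = refl
    e∷ (suc i) = e i

SameType : (M N : OStr) → ∀ {n} → Vector (OStr.Carrier M) n → Vector (OStr.Carrier N) n → Set
SameType M N {n} ρ σ = (φ : Formula n) → Sat M φ ρ ⇔ Sat N φ σ

SameType-sym : ∀ {M N n} {ρ : Vector (OStr.Carrier M) n} {σ : Vector (OStr.Carrier N) n} →
  SameType M N ρ σ → SameType N M σ ρ
SameType-sym T φ = mk⇔ (Equivalence.from (T φ)) (Equivalence.to (T φ))

enumerate : ∀ {A : Set} k → Vector A k → A → ℕ → A
enumerate zero    ρ d i       = d
enumerate (suc k) ρ d zero    = ρ zero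
enumerate (suc k) ρ d (suc i) = enumerate k (ρ ∘ suc) d i

enumerate-toℕ : ∀ {A : Set} k (ρ : Vector A k) d (j : Fin k) → enumerate k ρ d (toℕ j) ≡ ρ j
enumerate-toℕ (suc k) ρ d zero    = refl
enumerate-toℕ (suc k) ρ d (suc j) = enumerate-toℕ k (ρ ∘ suc) d j

SameType-extend : ExcludedMiddle 0ℓ → (M N : OStr) → IsAleph1Saturated N →
  ∀ {k} {ρ : Vector (OStr.Carrier M) k} {σ : Vector (OStr.Carrier N) k} →
  SameType M N ρ σ → (x : OStr.Carrier M) →
  Σ (OStr.Carrier N) λ y → SameType M N (x ∷ ρ) (y ∷ σ)
SameType-extend em M N satN {k} {ρ} {σ} T x = y , T∷
  where
  params : ℕ → OStr.Carrier N
  params = enumerate k σ (OStr.0# N)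

  -- the type of x over ρ, with the parameters taken from σ
  tp : ParamFormula → Set
  tp ψ = Σ (Formula (suc k)) λ χ → (ψ ≡ (k , χ , toℕ)) × Sat M χ (x ∷ ρ)

  conj : ∀ {L} → All tp L → Formula (suc k)
  conj All.[]               = ⊤F
  conj ((χ , _ , _) All.∷ ps) = andF χ (conj ps)

  conj-x : ∀ {L} (ps : All tp L) → Sat M (conj ps) (x ∷ ρ)
  conj-x All.[]               = λ (h , ¬h) → ¬h h
  conj-x ((_ , _ , s) All.∷ ps) = s , conj-x ps

  σ≗params : ∀ z (i : Fin (suc k)) → (z ∷ σ) i ≡ (z ∷ (params ∘ toℕ)) i
  σ≗params z zero    = refl
  σ≗params z (suc j) = ≡.sym (enumerate-toℕ k σ _ j)

  conj⇒All : ∀ {L} z (ps : All tp L) → Sat N (conj ps) (z ∷ σ) → All (SatP N params z) L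
  conj⇒All z All.[]                    _        = All.[]
  conj⇒All z ((χ , refl , _) All.∷ ps) (h , hs) = Sat-ext N χ (σ≗params z) h All.∷ conj⇒All z ps hs

  -- ∃ z. ⋀ L holds at ρ, hence at σ.
  finSat : FinitelySatisfiable N params tp
  finSat L ps with Equivalence.to (T (exF (conj ps))) (x , conj-x ps)
  ... | z , h = z , conj⇒All z ps h

  y : OStr.Carrier N
  y = proj₁ (satN params tp finSat)

  realises : ∀ χ → Sat M χ (x ∷ ρ) → Sat N χ (y ∷ σ)
  realises χ s = Sat-ext N χ (≡.sym ∘ σ≗params y)
    (proj₂ (satN params tp finSat) (k , χ , toℕ) (χ , refl , s))

  -- the type is complete, so ¬ χ is in it whenever χ is not
  T∷ : SameType M N (x ∷ ρ) (y ∷ σ)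
  T∷ χ = mk⇔ (realises χ) reflects
    where
    reflects : Sat N χ (y ∷ σ) → Sat M χ (x ∷ ρ)
    reflects s with em {Sat M χ (x ∷ ρ)}
    ... | yes h  = h
    ... | no ¬h = ⊥-elim (realises (notF χ) ¬h s)

module _ (em : ExcludedMiddle 0ℓ) (Γ : DOAG) where
  open DOAG Γ
  private module ≈ = IsEquivalence ≈-equiv

  evalT-times₀ : ∀ {k} n {u} (ρ : Vector Carrier k) → u ≈ one → evalT str (times₀ n) (u ∷ ρ) ≈ n·1 n
  evalT-times₀ zero    ρ e = ≈.refl
  evalT-times₀ (suc n) ρ e = +-cong (evalT-times₀ n ρ e) e

  IsMinPosF-one : ∀ {k} (ρ : Vector Carrier k) → Sat str IsMinPosF (one ∷ ρ)
  IsMinPosF-one ρ = proj₁ one-pos , proj₂ one-pos ,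
    λ (z , 0≤z , z≉0 , one≰z) → one≰z (one-min z 0≤z z≉0)

  IsMinPosF⇒≈one : ∀ {k} {u} (ρ : Vector Carrier k) → Sat str IsMinPosF (u ∷ ρ) → u ≈ one
  IsMinPosF⇒≈one {u = u} ρ (0≤u , u≉0 , minimal) = ≤-antisym u≤one (one-min u 0≤u u≉0)
    where
    u≤one : u ≤ one
    u≤one with em {u ≤ one}
    ... | yes h = h
    ... | no h  = ⊥-elim (minimal (one , proj₁ one-pos , proj₂ one-pos , h))

  InConv1⇒InConvF : ∀ {k} (d : Term k) ρ → InConv1 (evalT str d ρ) → ∃ λ n → Sat str (InConvF n d) ρ
  InConv1⇒InConvF d ρ (n , lo , hi) = n , one , IsMinPosF-one ρ ,
    ≤-resp (neg-cong (≈.sym (evalT-times₀ n ρ ≈.refl))) d≈ lo ,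
    ≤-resp d≈ (≈.sym (evalT-times₀ n ρ ≈.refl)) hi
    where d≈ = ≈.reflexive (≡.sym (evalT-wkT str d one ρ))

  InConvF⇒InConv1 : ∀ {k} (d : Term k) ρ → (∃ λ n → Sat str (InConvF n d) ρ) → InConv1 (evalT str d ρ)
  InConvF⇒InConv1 d ρ (n , u , isMin , lo , hi) = n ,
    ≤-resp (neg-cong (evalT-times₀ n ρ u≈one)) d≈ lo ,
    ≤-resp d≈ (evalT-times₀ n ρ u≈one) hi
    where
    u≈one = IsMinPosF⇒≈one ρ isMin
    d≈    = ≈.reflexive (evalT-wkT str d u ρ)

  evalT-Quot : ∀ {k} (t : Term k) ρ → evalT Quot t ρ ≡ evalT str t ρ
  evalT-Quot (var i)    ρ = refl
  evalT-Quot zer        ρ = refl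
  evalT-Quot (plus s t) ρ = cong₂ _+_ (evalT-Quot s ρ) (evalT-Quot t ρ)
  evalT-Quot (neg t)    ρ = cong -_ (evalT-Quot t ρ)

  Sat-Quot-eqF : ∀ {k} (s t : Term k) ρ →
    Sat Quot (eqF s t) ρ ≡ InConv1 (evalT str (plus s (neg t)) ρ)
  Sat-Quot-eqF s t ρ rewrite evalT-Quot s ρ | evalT-Quot t ρ = refl

  Sat-Quot-leF : ∀ {k} (s t : Term k) ρ →
    Sat Quot (leF s t) ρ ≡ (Sat str (leF s t) ρ ⊎ InConv1 (evalT str (plus s (neg t)) ρ))
  Sat-Quot-leF s t ρ rewrite evalT-Quot s ρ | evalT-Quot t ρ = refl

module Transfer (em : ExcludedMiddle 0ℓ) (Γ Γ' : DOAG) {k}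
  {ρ : Vector (DOAG.Carrier Γ) k} {σ : Vector (DOAG.Carrier Γ') k}
  (T : SameType (DOAG.str Γ) (DOAG.str Γ') ρ σ) where
  open DOAG using (str; Quot; InConv1)

  InConv1-transfer : ∀ (d : Term k) →
    InConv1 Γ (evalT (str Γ) d ρ) → InConv1 Γ' (evalT (str Γ') d σ)
  InConv1-transfer d h with InConv1⇒InConvF em Γ d ρ h
  ... | n , hn = InConvF⇒InConv1 em Γ' d σ (n , Equivalence.to (T (InConvF n d)) hn)

  eqF-transfer : ∀ s t → Sat (Quot Γ) (eqF s t) ρ → Sat (Quot Γ') (eqF s t) σ
  eqF-transfer s t h = subst id (≡.sym (Sat-Quot-eqF em Γ' s t σ))
    (InConv1-transfer (plus s (neg t)) (subst id (Sat-Quot-eqF em Γ s t ρ) h))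

  leF-transfer : ∀ s t → Sat (Quot Γ) (leF s t) ρ → Sat (Quot Γ') (leF s t) σ
  leF-transfer s t h = subst id (≡.sym (Sat-Quot-leF em Γ' s t σ))
    (Sum.map (Equivalence.to (T (leF s t))) (InConv1-transfer (plus s (neg t)))
      (subst id (Sat-Quot-leF em Γ s t ρ) h))

SameType⇒SameQuotType : ExcludedMiddle 0ℓ → (Γ Γ' : DOAG) →
  IsAleph1Saturated (DOAG.str Γ) → IsAleph1Saturated (DOAG.str Γ') →
  ∀ {k} {ρ : Vector (DOAG.Carrier Γ) k} {σ : Vector (DOAG.Carrier Γ') k} →
  SameType (DOAG.str Γ) (DOAG.str Γ') ρ σ → SameType (DOAG.Quot Γ) (DOAG.Quot Γ') ρ σ
SameType⇒SameQuotType em Γ Γ' satΓ satΓ' {ρ = ρ} {σ} T = go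
  where
  open DOAG using (str; Quot)
  module T  = Transfer em Γ Γ' T
  module T' = Transfer em Γ' Γ (SameType-sym T)
  IH = SameType⇒SameQuotType em Γ Γ' satΓ satΓ'

  go : SameType (Quot Γ) (Quot Γ') ρ σ
  go (eqF s t)  = mk⇔ (T.eqF-transfer s t) (T'.eqF-transfer s t)
  go (leF s t)  = mk⇔ (T.leF-transfer s t) (T'.leF-transfer s t)
  go (notF φ)   = mk⇔ (λ ¬h h → ¬h (Equivalence.from (go φ) h))
                      (λ ¬h h → ¬h (Equivalence.to (go φ) h))
  go (andF φ ψ) = mk⇔ (λ (a , b) → Equivalence.to (go φ) a , Equivalence.to (go ψ) b)
                      (λ (a , b) → Equivalence.from (go φ) a , Equivalence.from (go ψ) b)
  go (exF φ)    = mk⇔ forth back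
    where
    forth : Sat (Quot Γ) (exF φ) ρ → Sat (Quot Γ') (exF φ) σ
    forth (x , h) with SameType-extend em (str Γ) (str Γ') satΓ' T x
    ... | y , T∷ = y , Equivalence.to (IH T∷ φ) h
    back : Sat (Quot Γ') (exF φ) σ → Sat (Quot Γ) (exF φ) ρ
    back (y , h) with SameType-extend em (str Γ') (str Γ) satΓ (SameType-sym T) y
    ... | x , T∷ = x , Equivalence.from (IH (SameType-sym T∷) φ) h

proposition2p6 : ExcludedMiddle 0ℓ →
    (Γ Γ' : DOAG) →
    IsAleph1Saturated (DOAG.str Γ) → IsAleph1Saturated (DOAG.str Γ') →
    (f : DOAG.Carrier Γ → DOAG.Carrier Γ') →
    IsElementary (DOAG.str Γ) (DOAG.str Γ') f →
    IsElementary (DOAG.Quot Γ) (DOAG.Quot Γ') f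
proposition2p6 em Γ Γ' satΓ satΓ' f elem φ ρ =
  SameType⇒SameQuotType em Γ Γ' satΓ satΓ' (λ ψ → elem ψ ρ) φ
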